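{- Let $p$ be a prime, let $\boldsymbol{\alpha}=(\alpha_1,\ldots,\alpha_r)$ be a basis for a finite abelian $p$-group $G$ with $|\alpha_i|=p^{n_i}$, and let $j,j',k',k$ be integers with $0\le j\le j'<k'\le k$. Let $\beta\in G(j,k)$. Then: (i) If $\mathbf{x}=\mathrm{DL}_{\boldsymbol{\alpha}}(k',k,\beta^{p^{k'-j}})$ and $\gamma=\beta^{p^{j'-j}}\boldsymbol{\alpha}(j',k)^{ -\mathbf{x}}$, then $\gamma\in G(j',k')$. (ii) If moreover $\mathbf{v}=\mathrm{DL}_{\boldsymbol{\alpha}}(j',k',\gamma)$ and $\mathbf{s}=\mathbf{q}(j',k')/\mathbf{q}(j',k)$ (componentwise division of integer vectors), then $\mathbf{s}\mathbf{v}+\mathbf{x}=\mathrm{DL}_{\boldsymbol{\alpha}}(j',k,\beta^{p^{j'-j}})$, where $\mathbf{s}\mathbf{v}$ is the componentwise product.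
   Context: Groups are written multiplicatively. A vector $\boldsymbol{\alpha}=(\alpha_1,\ldots,\alpha_r)$ of elements of a finite abelian group is a basis (for $\langle\boldsymbol{\alpha}\rangle$) if every $\beta\in\langle\boldsymbol{\alpha}\rangle$ can be written uniquely as $\boldsymbol{\alpha}^{\mathbf{x}}=\alpha_1^{x_1}\cdots\alpha_r^{x_r}$ with $0\le x_i<|\alpha_i|$ (identity components allowed); this $\mathbf{x}$ is denoted $\mathrm{DL}(\boldsymbol{\alpha},\beta)$, viewed as an element of $\prod_i\mathbb{Z}/|\alpha_i|\mathbb{Z}$. For nonnegative integers $a<b$: $G(a,b)=\{\beta^{p^a}:\beta\in G,\ \beta^{p^b}=1_G\}$; $\mathbf{q}(a,b)=(q_1,\ldots,q_r)$ with $q_i=p^{\,a+\max(0,n_i-b)}$; $\boldsymbol{\alpha}(a,b)=(\alpha_1^{q_1},\ldots,\alpha_r^{q_r})$, which is a basis of $G(a,b)$; and $\mathrm{DL}_{\boldsymbol{\alpha}}(a,b,\delta)=\mathrm{DL}(\boldsymbol{\alpha}(a,b),\delta)$ for $\delta\in G(a,b)$. For a vector $\boldsymbol{\gamma}$ and integer vector $\mathbf{x}$, $\boldsymbol{\gamma}^{\mathbf{x}}=\prod_i\gamma_i^{x_i}$. -}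

module Defs where

open import Level using (Level; _⊔_)
open import Algebra.Bundles using (AbelianGroup)
open import Data.Nat using (ℕ; zero; suc; _+_; _*_; _∸_; _^_; _<_; _≤_; NonZero)
open import Data.Nat.Properties using (m^n≢0)
open import Data.Nat.Primality using (Prime; prime⇒nonZero)
open import Data.Fin using (Fin)
import Data.Fin as F
open import Data.Product using (Σ; ∃; _×_; _,_)
open import Data.Sum using (_⊎_)
open import Relation.Binary.PropositionalEquality using (_≡_)

module _ {c ℓ : Level} (G : AbelianGroup c ℓ) where
  open AbelianGroup G

  pow : Carrier → ℕ → Carrier
  pow g zero    = ε
  pow g (suc m) = g ∙ pow g m

  prod : (r : ℕ) → (Fin r → Carrier) → Carrier
  prod zero    g = ε
  prod (suc r) g = g F.zero ∙ prod r (λ i → g (F.suc i))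

  vpow : {r : ℕ} → (Fin r → Carrier) → (Fin r → ℕ) → Carrier
  vpow {r} γ x = prod r (λ i → pow (γ i) (x i))

  IsOrder : Carrier → ℕ → Set ℓ
  IsOrder g m = (0 < m) × (pow g m ≈ ε) × (∀ k → 0 < k → pow g k ≈ ε → m ≤ k)

  IsDL : {r : ℕ} → (Fin r → Carrier) → Carrier → (Fin r → ℕ) → Set ℓ
  IsDL γ δ x = (∀ i m → IsOrder (γ i) m → x i < m) × (vpow γ x ≈ δ)

  IsBasisOfG : {r : ℕ} → (Fin r → Carrier) → Set (c ⊔ ℓ)
  IsBasisOfG {r} α =
      (∀ β → Σ (Fin r → ℕ) λ x → IsDL α β x)
    × (∀ β x y → IsDL α β x → IsDL α β y → ∀ i → x i ≡ y i)

  InG : (p a b : ℕ) → Carrier → Set (c ⊔ ℓ)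
  InG p a b δ = ∃ λ β → (pow β (p ^ b) ≈ ε) × (pow β (p ^ a) ≈ δ)

  αab : {r : ℕ} → (p : ℕ) → (Fin r → ℕ) → (Fin r → Carrier) → ℕ → ℕ → Fin r → Carrier
  αab p n α a b i = pow (α i) (p ^ (a + (n i ∸ b)))

qv : {r : ℕ} → (p : ℕ) → (Fin r → ℕ) → ℕ → ℕ → Fin r → ℕ
qv p n a b i = p ^ (a + (n i ∸ b))

qdiv : {r : ℕ} → (p : ℕ) → Prime p → (Fin r → ℕ) → ℕ → ℕ → ℕ → ℕ → Fin r → ℕ
qdiv p pp n a b a' b' i =
  Data.Nat._/_ (qv p n a b i) (qv p n a' b' i) {{m^n≢0 p (a' + (n i ∸ b')) {{prime⇒nonZero pp}}}}

ModEq : ℕ → ℕ → ℕ → Set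
ModEq m a b = ∃ λ t → (a ≡ b + t * m) ⊎ (b ≡ a + t * m)

{-# OPTIONS --safe #-}
module Submission where

open import Defs
open import Level using (Level)
open import Algebra.Bundles using (AbelianGroup)
open import Data.Nat using (ℕ; _+_; _*_; _∸_; _^_; _≤_; _<_)
open import Data.Nat.Primality using (Prime)
open import Data.Fin using (Fin)
open import Data.Product using (_×_)

open import Data.Nat using (zero; suc; NonZero; >-nonZero; _%_; _/_; s≤s; z≤n)
open import Data.Nat.Properties as ℕ using ()
open import Data.Nat.DivMod using (m≡m%n+[m/n]*n; m%n<n; m/n*n≡m)
open import Data.Nat.Divisibility using (_∣_; divides; m%n≡0⇒n∣m)
open import Data.Nat.Primality using (prime⇒nonZero)
import Data.Fin as Fin
open import Data.Product using (_,_; proj₂; ∃)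
open import Data.Sum using (inj₁; inj₂)
open import Data.Empty using (⊥-elim)
open import Algebra.Properties.CommutativeSemigroup ℕ.+-commutativeSemigroup as +-CS using ()
open import Algebra.Properties.CommutativeSemigroup ℕ.*-commutativeSemigroup as *-CS using ()
import Relation.Binary.PropositionalEquality as P

-- Write β = δ^{p^j} with δ^{p^k} = 1 and put w = α(0,k)^x. Since w^{p^a} = α(a,k)^x,
-- the element η = δ w⁻¹ has η^{p^{j'}} = γ and η^{p^{k'}} = β^{p^{k'-j}} α(k',k)^{-x} = 1,
-- so γ ∈ G(j',k'). For (ii), α(j',k)_i^{s_i} = α(j',k')_i, hence
-- α(j',k)^{sv+x} = γ α(j',k)^x = β^{p^{j'-j}} = α(j',k)^y. As α is a basis, the
-- components α(j',k)_i^{(sv+x)_i} and α(j',k)_i^{y_i} agree, i.e. the exponents agree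
-- modulo the order of α(j',k)_i.

qv-split : ∀ p {r} (n : Fin r → ℕ) a {k' k} → k' ≤ k →
           ∀ i → qv p n a k' i P.≡ p ^ ((n i ∸ k') ∸ (n i ∸ k)) * qv p n a k i
qv-split p n a {k'} {k} k'≤k i = begin
  p ^ (a + (n i ∸ k'))         ≡⟨ P.cong (λ t → p ^ (a + t)) (ℕ.m∸n+n≡m (ℕ.∸-monoʳ-≤ (n i) k'≤k)) ⟨
  p ^ (a + (d + (n i ∸ k)))    ≡⟨ P.cong (p ^_) (+-CS.x∙yz≈y∙xz a d (n i ∸ k)) ⟩
  p ^ (d + (a + (n i ∸ k)))    ≡⟨ ℕ.^-distribˡ-+-* p d (a + (n i ∸ k)) ⟩
  p ^ d * p ^ (a + (n i ∸ k))  ∎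
  where
  open P.≡-Reasoning
  d : ℕ
  d = (n i ∸ k') ∸ (n i ∸ k)

qdiv-*-qv : ∀ {p} (pp : Prime p) {r} (n : Fin r → ℕ) a {k' k} → k' ≤ k →
            ∀ i → qdiv p pp n a k' a k i * qv p n a k i P.≡ qv p n a k' i
qdiv-*-qv {p} pp n a {k'} {k} k'≤k i =
  m/n*n≡m {qv p n a k' i} {qv p n a k i} {{ℕ.m^n≢0 p (a + (n i ∸ k)) {{prime⇒nonZero pp}}}}
          (divides (p ^ ((n i ∸ k') ∸ (n i ∸ k))) (qv-split p n a k'≤k i))

module _ {c ℓ : Level} (G : AbelianGroup c ℓ) where
  open AbelianGroup G
  open import Relation.Binary.Reasoning.Setoid setoid
  open import Algebra.Properties.AbelianGroup G using (ε⁻¹≈ε; ⁻¹-∙-comm; identityʳ-unique)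
  open import Algebra.Properties.CommutativeSemigroup commutativeSemigroup using (interchange)

  pow-cong : ∀ {g h} m → g ≈ h → pow G g m ≈ pow G h m
  pow-cong zero    g≈h = refl
  pow-cong (suc m) g≈h = ∙-cong g≈h (pow-cong m g≈h)

  pow-congʳ : ∀ g {a b} → a P.≡ b → pow G g a ≈ pow G g b
  pow-congʳ g a≡b = reflexive (P.cong (pow G g) a≡b)

  pow-homo-+ : ∀ g a b → pow G g (a + b) ≈ pow G g a ∙ pow G g b
  pow-homo-+ g zero    b = sym (identityˡ _)
  pow-homo-+ g (suc a) b = trans (∙-congˡ (pow-homo-+ g a b)) (sym (assoc _ _ _))

  pow-ε : ∀ m → pow G ε m ≈ ε
  pow-ε zero    = refl
  pow-ε (suc m) = trans (identityˡ _) (pow-ε m)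

  pow-distrib-∙ : ∀ g h m → pow G (g ∙ h) m ≈ pow G g m ∙ pow G h m
  pow-distrib-∙ g h zero    = sym (identityˡ ε)
  pow-distrib-∙ g h (suc m) =
    trans (∙-congˡ (pow-distrib-∙ g h m)) (interchange g h (pow G g m) (pow G h m))

  pow-⁻¹ : ∀ g m → pow G (g ⁻¹) m ≈ pow G g m ⁻¹
  pow-⁻¹ g zero    = sym ε⁻¹≈ε
  pow-⁻¹ g (suc m) = trans (∙-congˡ (pow-⁻¹ g m)) (⁻¹-∙-comm g (pow G g m))

  pow-pow : ∀ g a b → pow G (pow G g a) b ≈ pow G g (a * b)
  pow-pow g zero    b = pow-ε b
  pow-pow g (suc a) b = begin
    pow G (g ∙ pow G g a) b            ≈⟨ pow-distrib-∙ g (pow G g a) b ⟩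
    pow G g b ∙ pow G (pow G g a) b    ≈⟨ ∙-congˡ (pow-pow g a b) ⟩
    pow G g b ∙ pow G g (a * b)        ≈⟨ pow-homo-+ g b (a * b) ⟨
    pow G g (b + a * b)                ∎

  pow-pow-comm : ∀ g a b → pow G (pow G g a) b ≈ pow G (pow G g b) a
  pow-pow-comm g a b = begin
    pow G (pow G g a) b   ≈⟨ pow-pow g a b ⟩
    pow G g (a * b)       ≈⟨ pow-congʳ g (ℕ.*-comm a b) ⟩
    pow G g (b * a)       ≈⟨ pow-pow g b a ⟨
    pow G (pow G g b) a   ∎

  prod-cong : ∀ r {f h : Fin r → Carrier} → (∀ i → f i ≈ h i) → prod G r f ≈ prod G r h
  prod-cong zero    f≈h = refl
  prod-cong (suc r) f≈h = ∙-cong (f≈h Fin.zero) (prod-cong r (λ i → f≈h (Fin.suc i)))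

  prod-distrib-∙ : ∀ r (f h : Fin r → Carrier) →
                   prod G r (λ i → f i ∙ h i) ≈ prod G r f ∙ prod G r h
  prod-distrib-∙ zero    f h = sym (identityˡ ε)
  prod-distrib-∙ (suc r) f h = trans (∙-congˡ (prod-distrib-∙ r _ _)) (interchange _ _ _ _)

  pow-prod : ∀ r (f : Fin r → Carrier) m → pow G (prod G r f) m ≈ prod G r (λ i → pow G (f i) m)
  pow-prod zero    f m = pow-ε m
  pow-prod (suc r) f m = trans (pow-distrib-∙ _ _ m) (∙-congˡ (pow-prod r _ m))

  vpow-homo-+ : ∀ {r} (γ : Fin r → Carrier) (a b : Fin r → ℕ) →
                vpow G γ (λ i → a i + b i) ≈ vpow G γ a ∙ vpow G γ b
  vpow-homo-+ {r} γ a b =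
    trans (prod-cong r (λ i → pow-homo-+ (γ i) (a i) (b i))) (prod-distrib-∙ r _ _)

  pow-vpow : ∀ {r} (γ : Fin r → Carrier) x m →
             pow G (vpow G γ x) m ≈ vpow G (λ i → pow G (γ i) m) x
  pow-vpow {r} γ x m =
    trans (pow-prod r _ m) (prod-cong r (λ i → pow-pow-comm (γ i) (x i) m))

  vpow-pow : ∀ {r} (γ : Fin r → Carrier) (e x : Fin r → ℕ) →
             vpow G (λ i → pow G (γ i) (e i)) x ≈ vpow G γ (λ i → e i * x i)
  vpow-pow {r} γ e x = prod-cong r (λ i → pow-pow (γ i) (e i) (x i))

  pow-% : ∀ g m .{{_ : NonZero m}} a → pow G g m ≈ ε → pow G g a ≈ pow G g (a % m)
  pow-% g m a gᵐ≈ε = begin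
    pow G g a                                  ≈⟨ pow-congʳ g (m≡m%n+[m/n]*n a m) ⟩
    pow G g (a % m + (a / m) * m)              ≈⟨ pow-homo-+ g (a % m) _ ⟩
    pow G g (a % m) ∙ pow G g ((a / m) * m)    ≈⟨ ∙-congˡ (pow-congʳ g (ℕ.*-comm (a / m) m)) ⟩
    pow G g (a % m) ∙ pow G g (m * (a / m))    ≈⟨ ∙-congˡ (pow-pow g m (a / m)) ⟨
    pow G g (a % m) ∙ pow G (pow G g m) (a / m) ≈⟨ ∙-congˡ (pow-cong (a / m) gᵐ≈ε) ⟩
    pow G g (a % m) ∙ pow G ε (a / m)          ≈⟨ ∙-congˡ (pow-ε (a / m)) ⟩
    pow G g (a % m) ∙ ε                        ≈⟨ identityʳ _ ⟩
    pow G g (a % m)                            ∎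

  order-unique : ∀ {g m m'} → IsOrder G g m → IsOrder G g m' → m P.≡ m'
  order-unique (m>0 , gᵐ≈ε , minimal) (m'>0 , gᵐ'≈ε , minimal') =
    ℕ.≤-antisym (minimal _ m'>0 gᵐ'≈ε) (minimal' _ m>0 gᵐ≈ε)

  order-minimal : ∀ {g m ρ} → IsOrder G g m → ρ < m → pow G g ρ ≈ ε → ρ P.≡ 0
  order-minimal {ρ = zero}  _                 _   _     = P.refl
  order-minimal {ρ = suc ρ} (_ , _ , minimal) ρ<m gᵖ≈ε =
    ⊥-elim (ℕ.<⇒≱ ρ<m (minimal (suc ρ) (s≤s z≤n) gᵖ≈ε))

  order-∣ : ∀ {g m d} → IsOrder G g m → pow G g d ≈ ε → m ∣ d
  order-∣ {g} {m} {d} o@(m>0 , gᵐ≈ε , _) gᵈ≈ε =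
    m%n≡0⇒n∣m d m (order-minimal o (m%n<n d m) (trans (sym (pow-% g m d gᵐ≈ε)) gᵈ≈ε))
    where instance _ = >-nonZero m>0

  pow-≈⇒pow-∸≈ε : ∀ g {a b} → a ≤ b → pow G g a ≈ pow G g b → pow G g (b ∸ a) ≈ ε
  pow-≈⇒pow-∸≈ε g {a} {b} a≤b gᵃ≈gᵇ = identityʳ-unique _ _ (begin
    pow G g a ∙ pow G g (b ∸ a)   ≈⟨ pow-homo-+ g a (b ∸ a) ⟨
    pow G g (a + (b ∸ a))         ≈⟨ pow-congʳ g (ℕ.m+[n∸m]≡n a≤b) ⟩
    pow G g b                     ≈⟨ gᵃ≈gᵇ ⟨
    pow G g a                     ∎)

  pow-≈⇒≡+*order : ∀ {g m a b} → IsOrder G g m → a ≤ b → pow G g a ≈ pow G g b →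
                   ∃ λ t → b P.≡ a + t * m
  pow-≈⇒≡+*order {g} {a = a} o a≤b gᵃ≈gᵇ =
    let divides t b∸a≡t*m = order-∣ o (pow-≈⇒pow-∸≈ε g a≤b gᵃ≈gᵇ)
    in t , P.trans (P.sym (ℕ.m+[n∸m]≡n a≤b)) (P.cong (a +_) b∸a≡t*m)

  pow-≈⇒ModEq : ∀ {g m} → IsOrder G g m → ∀ a b → pow G g a ≈ pow G g b → ModEq m a b
  pow-≈⇒ModEq o a b gᵃ≈gᵇ with ℕ.≤-total a b
  ... | inj₁ a≤b = let t , b≡ = pow-≈⇒≡+*order o a≤b gᵃ≈gᵇ in t , inj₂ b≡
  ... | inj₂ b≤a = let t , a≡ = pow-≈⇒≡+*order o b≤a (sym gᵃ≈gᵇ) in t , inj₁ a≡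

  module _ {r : ℕ} {α : Fin r → Carrier} {N : Fin r → ℕ}
           (basis : IsBasisOfG G α) (ord : ∀ i → IsOrder G (α i) (N i)) where

    private
      instance
        N≢0 : ∀ {i} → NonZero (N i)
        N≢0 {i} = let (N>0 , _) = ord i in >-nonZero N>0

      αᴺ≈ε : ∀ i → pow G (α i) (N i) ≈ ε
      αᴺ≈ε i = let (_ , αᴺ≈ε , _) = ord i in αᴺ≈ε

      -- Uniqueness in IsBasisOfG only covers exponents below the orders, hence the reduction.
      reduce : (Fin r → ℕ) → Fin r → ℕ
      reduce z i = z i % N i

      vpow-reduce : ∀ z → vpow G α z ≈ vpow G α (reduce z)
      vpow-reduce z = prod-cong r (λ i → pow-% (α i) (N i) (z i) (αᴺ≈ε i))

      reduce-DL : ∀ z {g} → vpow G α z ≈ g → IsDL G α g (reduce z)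
      reduce-DL z αᶻ≈g = (λ i m oₘ → P.subst (reduce z i <_) (order-unique (ord i) oₘ) (m%n<n (z i) (N i)))
                       , trans (sym (vpow-reduce z)) αᶻ≈g

    basis-pow-unique : ∀ a b → vpow G α a ≈ vpow G α b →
                       ∀ i → pow G (α i) (a i) ≈ pow G (α i) (b i)
    basis-pow-unique a b αᵃ≈αᵇ i = begin
      pow G (α i) (a i)          ≈⟨ pow-% (α i) (N i) (a i) (αᴺ≈ε i) ⟩
      pow G (α i) (reduce a i)   ≡⟨ P.cong (pow G (α i)) reduced-equal ⟩
      pow G (α i) (reduce b i)   ≈⟨ pow-% (α i) (N i) (b i) (αᴺ≈ε i) ⟨
      pow G (α i) (b i)          ∎
      where
      reduced-equal : reduce a i P.≡ reduce b i
      reduced-equal = proj₂ basis _ _ _ (reduce-DL a αᵃ≈αᵇ) (reduce-DL b refl) i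

    basis-powers-ModEq : ∀ (e : Fin r → ℕ) {a b} →
                         vpow G (λ i → pow G (α i) (e i)) a ≈ vpow G (λ i → pow G (α i) (e i)) b →
                         ∀ i m → IsOrder G (pow G (α i) (e i)) m → ModEq m (a i) (b i)
    basis-powers-ModEq e {a} {b} γᵃ≈γᵇ i m oₘ = pow-≈⇒ModEq oₘ (a i) (b i) (begin
      pow G (pow G (α i) (e i)) (a i)   ≈⟨ pow-pow (α i) (e i) (a i) ⟩
      pow G (α i) (e i * a i)           ≈⟨ basis-pow-unique (λ i → e i * a i) (λ i → e i * b i) αᵉᵃ≈αᵉᵇ i ⟩
      pow G (α i) (e i * b i)           ≈⟨ pow-pow (α i) (e i) (b i) ⟨
      pow G (pow G (α i) (e i)) (b i)   ∎)
      where
      αᵉᵃ≈αᵉᵇ : vpow G α (λ i → e i * a i) ≈ vpow G α (λ i → e i * b i)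
      αᵉᵃ≈αᵉᵇ = trans (sym (vpow-pow α e a)) (trans γᵃ≈γᵇ (vpow-pow α e b))

  module _ (p : ℕ) {r : ℕ} (n : Fin r → ℕ) (α : Fin r → Carrier) where

    pow-p^-αab : ∀ a b c i → pow G (αab G p n α a b i) (p ^ c) ≈ αab G p n α (a + c) b i
    pow-p^-αab a b c i = begin
      pow G (pow G (α i) (p ^ (a + e))) (p ^ c)   ≈⟨ pow-pow (α i) (p ^ (a + e)) (p ^ c) ⟩
      pow G (α i) (p ^ (a + e) * p ^ c)           ≡⟨ P.cong (pow G (α i)) (ℕ.^-distribˡ-+-* p (a + e) c) ⟨
      pow G (α i) (p ^ (a + e + c))               ≡⟨ P.cong (λ t → pow G (α i) (p ^ t)) (+-CS.xy∙z≈xz∙y a e c) ⟩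
      pow G (α i) (p ^ (a + c + e))               ∎
      where
      e : ℕ
      e = n i ∸ b

    pow-p^-vpow-αab : ∀ a b c x → pow G (vpow G (αab G p n α a b) x) (p ^ c) ≈ vpow G (αab G p n α (a + c) b) x
    pow-p^-vpow-αab a b c x =
      trans (pow-vpow _ x (p ^ c)) (prod-cong r (λ i → pow-cong (x i) (pow-p^-αab a b c i)))

    vpow-αab-qdiv : (pp : Prime p) → ∀ a {k' k} → k' ≤ k → ∀ v →
                    vpow G (αab G p n α a k) (λ i → qdiv p pp n a k' a k i * v i) ≈ vpow G (αab G p n α a k') v
    vpow-αab-qdiv pp a {k'} {k} k'≤k v = prod-cong r λ i → begin
      pow G (pow G (α i) (qv p n a k i)) (s i * v i)   ≈⟨ pow-pow (α i) (qv p n a k i) (s i * v i) ⟩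
      pow G (α i) (qv p n a k i * (s i * v i))         ≡⟨ P.cong (pow G (α i)) (*-CS.x∙yz≈yx∙z (qv p n a k i) (s i) (v i)) ⟩
      pow G (α i) (s i * qv p n a k i * v i)           ≡⟨ P.cong (λ t → pow G (α i) (t * v i)) (qdiv-*-qv pp n a k'≤k i) ⟩
      pow G (α i) (qv p n a k' i * v i)                ≈⟨ pow-pow (α i) (qv p n a k' i) (v i) ⟨
      pow G (pow G (α i) (qv p n a k' i)) (v i)        ∎
      where
      s : Fin r → ℕ
      s = qdiv p pp n a k' a k

  pow-p^-shift : ∀ p {δ β j} → pow G δ (p ^ j) ≈ β → ∀ {a} → j ≤ a → pow G δ (p ^ a) ≈ pow G β (p ^ (a ∸ j))
  pow-p^-shift p {δ} {β} {j} δʲ≈β {a} j≤a = begin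
    pow G δ (p ^ a)                        ≡⟨ P.cong (λ t → pow G δ (p ^ t)) (ℕ.m+[n∸m]≡n j≤a) ⟨
    pow G δ (p ^ (j + (a ∸ j)))            ≡⟨ P.cong (pow G δ) (ℕ.^-distribˡ-+-* p j (a ∸ j)) ⟩
    pow G δ (p ^ j * p ^ (a ∸ j))          ≈⟨ pow-pow δ (p ^ j) (p ^ (a ∸ j)) ⟨
    pow G (pow G δ (p ^ j)) (p ^ (a ∸ j))  ≈⟨ pow-cong (p ^ (a ∸ j)) δʲ≈β ⟩
    pow G β (p ^ (a ∸ j))                  ∎

lemma2 : {c ℓ : Level} (G : AbelianGroup c ℓ) (p : ℕ) (pp : Prime p)
         {r : ℕ} (α : Fin r → AbelianGroup.Carrier G) (n : Fin r → ℕ)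
         → IsBasisOfG G α
         → (∀ i → IsOrder G (α i) (p ^ n i))
         → (j j' k' k : ℕ) → j ≤ j' → j' < k' → k' ≤ k
         → (β : AbelianGroup.Carrier G) → InG G p j k β
         → (x : Fin r → ℕ)
         → IsDL G (αab G p n α k' k) (pow G β (p ^ (k' ∸ j))) x
         → let γ = AbelianGroup._∙_ G (pow G β (p ^ (j' ∸ j)))
                     (AbelianGroup._⁻¹ G (vpow G (αab G p n α j' k) x))
           in InG G p j' k' γ
              × ((v : Fin r → ℕ) → IsDL G (αab G p n α j' k') γ v
                 → (y : Fin r → ℕ) → IsDL G (αab G p n α j' k) (pow G β (p ^ (j' ∸ j))) y
                 → ∀ i m → IsOrder G (αab G p n α j' k i) m
                 → ModEq m (qdiv p pp n j' k' j' k i * v i + x i) (y i))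
lemma2 G p pp {r} α n basis ord j j' k' k j≤j' j'<k' k'≤k β (δ , _ , δʲ≈β) x (_ , αx≈βᵏ') =
  (η , ηᵏ'≈ε , ηʲ'≈γ) ,
  λ v (_ , αv≈γ) y (_ , αy≈B) →
    basis-powers-ModEq G basis ord (qv p n j' k) (trans (sv+x-represents-B v αv≈γ) (sym αy≈B))
  where
  open AbelianGroup G
  open import Relation.Binary.Reasoning.Setoid setoid
  open import Algebra.Properties.Group group using (//-rightDividesˡ)

  B : Carrier
  B = pow G β (p ^ (j' ∸ j))
  X : Carrier
  X = vpow G (αab G p n α j' k) x
  w : Carrier
  w = vpow G (αab G p n α 0 k) x
  η : Carrier
  η = δ ∙ w ⁻¹
  s : Fin r → ℕ
  s = qdiv p pp n j' k' j' k

  ηᵃ : ∀ a → j ≤ a → pow G η (p ^ a) ≈ pow G β (p ^ (a ∸ j)) ∙ vpow G (αab G p n α a k) x ⁻¹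
  ηᵃ a j≤a = begin
    pow G (δ ∙ w ⁻¹) (p ^ a)                ≈⟨ pow-distrib-∙ G δ (w ⁻¹) (p ^ a) ⟩
    pow G δ (p ^ a) ∙ pow G (w ⁻¹) (p ^ a)  ≈⟨ ∙-cong (pow-p^-shift G p δʲ≈β j≤a) (pow-⁻¹ G w (p ^ a)) ⟩
    pow G β (p ^ (a ∸ j)) ∙ pow G w (p ^ a) ⁻¹
      ≈⟨ ∙-congˡ (⁻¹-cong (pow-p^-vpow-αab G p n α 0 k a x)) ⟩
    pow G β (p ^ (a ∸ j)) ∙ vpow G (αab G p n α a k) x ⁻¹ ∎

  ηʲ'≈γ : pow G η (p ^ j') ≈ B ∙ X ⁻¹
  ηʲ'≈γ = ηᵃ j' j≤j'

  ηᵏ'≈ε : pow G η (p ^ k') ≈ ε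
  ηᵏ'≈ε = trans (ηᵃ k' (ℕ.≤-trans j≤j' (ℕ.<⇒≤ j'<k'))) (trans (∙-congˡ (⁻¹-cong αx≈βᵏ')) (inverseʳ _))

  sv+x-represents-B : ∀ v → vpow G (αab G p n α j' k') v ≈ B ∙ X ⁻¹ →
                      vpow G (αab G p n α j' k) (λ i → s i * v i + x i) ≈ B
  sv+x-represents-B v αv≈γ = begin
    vpow G (αab G p n α j' k) (λ i → s i * v i + x i)   ≈⟨ vpow-homo-+ G _ (λ i → s i * v i) x ⟩
    vpow G (αab G p n α j' k) (λ i → s i * v i) ∙ X     ≈⟨ ∙-congʳ (vpow-αab-qdiv G p n α pp j' k'≤k v) ⟩
    vpow G (αab G p n α j' k') v ∙ X                    ≈⟨ ∙-congʳ αv≈γ ⟩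
    (B ∙ X ⁻¹) ∙ X                                      ≈⟨ //-rightDividesˡ X B ⟩
    B                                                   ∎
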